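{- Let $m$ be a positive integer. Every positive integer solution $n$ of \[\sigma_2(n)-n^2=L_{2m}\,n-(F_{2m}^2-1)\] with $n>(L_{2m}+F_{2m}^2-1)^3$ is of one of the following forms: (i) $n=F_{2k+1}F_{2k+2m+1}$ for some integer $k\ge 0$, where both $F_{2k+1}$ and $F_{2k+2m+1}$ are primes; (ii) $n=F_{2k+1}F_{2m-2k-1}$ for some integer $k$ with $0\le k<m$ and $k\neq \frac{m-1}{2}$, where both $F_{2k+1}$ and $F_{2m-2k-1}$ are primes.
   Context: $\sigma_2(n)=\sum_{d\mid n}d^2$. $F_n$ are the Fibonacci numbers ($F_0=0$, $F_1=1$, $F_{n}=F_{n-1}+F_{n-2}$) and $L_n$ are the Lucas numbers ($L_0=2$, $L_1=1$, $L_n=L_{n-1}+L_{n-2}$). A Fibonacci prime is a Fibonacci number that is prime. -}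

module Defs where

open import Data.Nat using (ℕ; zero; suc; _+_; _*_; _^_)
open import Data.Nat.Divisibility using (_∣?_)
open import Data.List using (List; filter; map; upTo)
open import Data.Nat.ListAction using (sum)

F : ℕ → ℕ
F zero = 0
F (suc zero) = 1
F (suc (suc n)) = F (suc n) + F n

L : ℕ → ℕ
L zero = 2
L (suc zero) = 1
L (suc (suc n)) = L (suc n) + L n

divisors : ℕ → List ℕ
divisors n = filter (_∣? n) (map suc (upTo n))

σ₂ : ℕ → ℕ
σ₂ n = sum (map (λ d → d ^ 2) (divisors n))

module Submission where

-- Put l = L(2m) and f = F(2m); over ℕ the equation reads σ₂(n) + f² = l n + n² + 1
-- (the relation Solves l f n), and Cassini's identity gives l² = 5 f² + 4.
--
-- 1. σ₂ is bounded above by the square sum of any list covering the divisors of n,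
--    and below by the square sum of any list of distinct divisors of n.
-- 2. Factor n > 1.  If n is prime, a prime square, or has three factors > 1, the
--    equation forces n ≤ f² resp. n ≤ l³, hence n ≤ X³ for X = l + f² − 1.
--    Otherwise n = p q with primes p < q and p² + q² + f² = l p q; if l p > 2 q this
--    gives q ≤ f², again n ≤ X³.
-- 3. In the remaining case 2q = l p + w, and l² = 5 f² + 4 turns the equation into
--    w² + 4 f² = 5 f² p².  So f ∣ w, and w = f z with z² + 4 = 5 p².
-- 4. By descent, the solutions of z² − 5 x² = ±4 are exactly the pairs (L j, F j),
--    with j odd for −4.  Hence p = F(2k+1), z = L(2k+1), and the addition formula
--    gives 2q = L(2m) F(2k+1) + F(2m) L(2k+1) = 2 F(2k+2m+1).
-- Thus every solution above the bound is of form (i); form (ii) never arises there.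

open import Defs
open import Data.Nat using (ℕ; suc; _+_; _*_; _^_; _∸_; _<_; _>_)
open import Data.Integer using (ℤ; +_) renaming (_+_ to _+ℤ_; _*_ to _*ℤ_; _-_ to _-ℤ_)
open import Data.Nat.Primality using (Prime)
open import Data.Product using (∃; _×_)
open import Data.Sum using (_⊎_)
open import Relation.Binary.PropositionalEquality using (_≡_; _≢_)

open import Data.Nat
  using (zero; _≤_; _≤?_; s≤s; z≤n; z<s; NonZero; _/_; >-nonZero; ≢-nonZero; ≢-nonZero⁻¹; n>1⇒nonTrivial; nonTrivial⇒n>1)
open import Data.Nat.Properties
open import Data.Nat.Induction using (<-rec)
open import Data.Nat.Tactic.RingSolver using (solve-∀)
open import Data.Nat.Divisibility
  using (_∣_; _∣?_; divides; ∣⇒≤; 0∣⇒≡0; 1∣_; ∣-refl; ∣-trans; m∣m*n; n∣m*n; *-cancelˡ-∣; *-cancelʳ-∣; ∣m+n∣m⇒∣n)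
open import Data.Nat.Divisibility.Core using (hasNonTrivialDivisor)
open import Data.Nat.DivMod using (m/n*n≡m)
open import Data.Nat.GCD using (gcd; gcd[m,n]∣m; gcd[m,n]∣n; gcd[m,n]≢0)
open import Data.Nat.Coprimality using (Coprime; coprime-/gcd; coprime-divisor)
open import Data.Nat.Primality using (prime⇒irreducible; prime⇒nonZero; prime⇒nonTrivial; prime?; ¬prime⇒composite)
open import Data.Nat.ListAction using (sum)
open import Data.Nat.ListAction.Properties using (sum-↭)
open import Data.Integer.Properties using (+-injective; pos-*)
import Data.Integer.Tactic.RingSolver as ℤ-Solver
open import Data.Bool using (Bool; true; false; not)
open import Data.Bool.Properties using (not-involutive)
open import Data.List using (List; []; _∷_; _++_; map; filter; upTo)
open import Data.List.Properties using (map-cong)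
open import Data.List.Membership.Propositional using (_∈_)
open import Data.List.Membership.Propositional.Properties
  using (∈-∃++; ∈-++⁻; ∈-++⁺ˡ; ∈-++⁺ʳ; ∈-filter⁺; ∈-filter⁻; ∈-map⁺; ∈-upTo⁺)
open import Data.List.Relation.Binary.Subset.Propositional using (_⊆_)
open import Data.List.Relation.Binary.Permutation.Propositional.Properties using (shift)
import Data.List.Relation.Binary.Permutation.Propositional.Properties as Perm
open import Data.List.Relation.Unary.All as All using (All; []; _∷_)
open import Data.List.Relation.Unary.Any using (here; there)
open import Data.List.Relation.Unary.Unique.Propositional using (Unique; []; _∷_)
import Data.List.Relation.Unary.Unique.Propositional.Properties as Unique
open import Data.Product using (∃₂; _,_; proj₁; proj₂)
open import Data.Sum using (inj₁; inj₂; [_,_]′)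
import Data.Sum as Sum
open import Data.Empty using (⊥-elim)
open import Relation.Nullary using (yes; no; ¬_)
open import Relation.Binary using (tri<; tri≈; tri>)
open import Relation.Binary.PropositionalEquality

cancel-2 : ∀ {a b} → 2 * a ≡ 2 * b → a ≡ b
cancel-2 {a} {b} = *-cancelˡ-≡ a b 2

double-F-suc : ∀ j → 2 * F (suc j) ≡ L j + F j
double-F-suc zero = refl
double-F-suc (suc zero) = refl
double-F-suc (suc (suc j)) = begin
  2 * (F (suc (suc j)) + F (suc j))                       ≡⟨ *-distribˡ-+ 2 (F (suc (suc j))) (F (suc j)) ⟩
  2 * F (suc (suc j)) + 2 * F (suc j)                     ≡⟨ cong₂ _+_ (double-F-suc (suc j)) (double-F-suc j) ⟩
  (L (suc j) + F (suc j)) + (L j + F j)                   ≡⟨ swap (L (suc j)) (F (suc j)) (L j) (F j) ⟩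
  (L (suc j) + L j) + (F (suc j) + F j)                   ∎
  where
  open ≡-Reasoning
  swap : ∀ a b c d → (a + b) + (c + d) ≡ (a + c) + (b + d)
  swap = solve-∀

double-L-suc : ∀ j → 2 * L (suc j) ≡ L j + 5 * F j
double-L-suc zero = refl
double-L-suc (suc zero) = refl
double-L-suc (suc (suc j)) = begin
  2 * (L (suc (suc j)) + L (suc j))                       ≡⟨ *-distribˡ-+ 2 (L (suc (suc j))) (L (suc j)) ⟩
  2 * L (suc (suc j)) + 2 * L (suc j)                     ≡⟨ cong₂ _+_ (double-L-suc (suc j)) (double-L-suc j) ⟩
  (L (suc j) + 5 * F (suc j)) + (L j + 5 * F j)           ≡⟨ swap (L (suc j)) (F (suc j)) (L j) (F j) ⟩
  (L (suc j) + L j) + 5 * (F (suc j) + F j)               ∎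
  where
  open ≡-Reasoning
  swap : ∀ a b c d → (a + 5 * b) + (c + 5 * d) ≡ (a + c) + 5 * (b + d)
  swap = solve-∀

L-suc : ∀ j → L (suc j) ≡ F (suc j) + 2 * F j
L-suc j = +-cancelʳ-≡ (F (suc j)) _ _ (begin
  L (suc j) + F (suc j)                 ≡⟨ double-F-suc (suc j) ⟨
  2 * (F (suc j) + F j)                 ≡⟨ regroup (F (suc j)) (F j) ⟩
  F (suc j) + 2 * F j + F (suc j)       ∎)
  where
  open ≡-Reasoning
  regroup : ∀ a b → 2 * (a + b) ≡ a + 2 * b + a
  regroup = solve-∀

F-add : ∀ a b → L a * F b + F a * L b ≡ 2 * F (a + b)
F-add zero b = +-identityʳ (2 * F b)
F-add (suc zero) b = begin
  1 * F b + 1 * L b     ≡⟨ cong₂ _+_ (*-identityˡ (F b)) (*-identityˡ (L b)) ⟩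
  F b + L b             ≡⟨ +-comm (F b) (L b) ⟩
  L b + F b             ≡⟨ double-F-suc b ⟨
  2 * F (suc b)         ∎
  where open ≡-Reasoning
F-add (suc (suc a)) b = begin
  (L (suc a) + L a) * F b + (F (suc a) + F a) * L b
    ≡⟨ regroup (L (suc a)) (L a) (F (suc a)) (F a) (F b) (L b) ⟩
  (L (suc a) * F b + F (suc a) * L b) + (L a * F b + F a * L b)
    ≡⟨ cong₂ _+_ (F-add (suc a) b) (F-add a b) ⟩
  2 * F (suc a + b) + 2 * F (a + b)
    ≡⟨ *-distribˡ-+ 2 (F (suc (a + b))) (F (a + b)) ⟨
  2 * F (suc (suc a) + b) ∎
  where
  open ≡-Reasoning
  regroup : ∀ a a' b b' c d → (a + a') * c + (b + b') * d ≡ (a * c + b * d) + (a' * c + b' * d)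
  regroup = solve-∀

F-pos : ∀ j → 0 < F (suc j)
F-pos zero = z<s
F-pos (suc j) = ≤-trans (F-pos j) (m≤m+n (F (suc j)) (F j))

F-even-pos : ∀ m → 0 < m → 0 < F (2 * m)
F-even-pos (suc m) _ = subst (λ j → 0 < F j) (sym (*-suc 2 m)) (F-pos (suc (2 * m)))

odd : ℕ → Bool
odd zero = false
odd (suc n) = not (odd n)

odd-double : ∀ k → odd (2 * k) ≡ false
odd-double zero = refl
odd-double (suc k) = begin
  odd (2 * suc k)             ≡⟨ cong odd (*-suc 2 k) ⟩
  not (not (odd (2 * k)))     ≡⟨ not-involutive (odd (2 * k)) ⟩
  odd (2 * k)                 ≡⟨ odd-double k ⟩
  false                       ∎
  where open ≡-Reasoning

odd⇒2k+1 : ∀ j → odd j ≡ true → ∃ λ k → j ≡ 2 * k + 1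
odd⇒2k+1 zero ()
odd⇒2k+1 (suc zero) _ = 0 , refl
odd⇒2k+1 (suc (suc j)) h with odd⇒2k+1 j (trans (sym (not-involutive (odd j))) h)
... | k , refl = suc k , cong (_+ 1) (sym (*-suc 2 k))

Norm : Bool → ℕ → ℕ → Set
Norm false z x = z * z ≡ 5 * (x * x) + 4
Norm true  z x = z * z + 4 ≡ 5 * (x * x)

-- Both steps (L j, F j) ↦ (L (j+1), F (j+1)) and back rest on this identity, which
-- says that (e + 2r, e) ↦ (3e + r, e + r) negates z² − 5x².
flip-identity : ∀ e r → (e + 2 * r) * (e + 2 * r) + (3 * e + r) * (3 * e + r)
                      ≡ 5 * (e * e) + 5 * ((e + r) * (e + r))
flip-identity = solve-∀

flip-identity′ : ∀ e r → (3 * e + r) * (3 * e + r) + (e + 2 * r) * (e + 2 * r)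
                       ≡ 5 * ((e + r) * (e + r)) + 5 * (e * e)
flip-identity′ = solve-∀

transfer⁺ : ∀ {A B C D} k → A + B ≡ C + D → A ≡ C + k → B + k ≡ D
transfer⁺ {A} {B} {C} {D} k eq refl =
  trans (+-comm B k) (+-cancelˡ-≡ C _ _ (trans (sym (+-assoc C k B)) eq))

transfer⁻ : ∀ {A B C D} k → A + B ≡ C + D → A + k ≡ C → B ≡ D + k
transfer⁻ {A} {B} {C} {D} k eq refl =
  +-cancelˡ-≡ A _ _ (trans eq (trans (+-assoc A k D) (cong (λ t → A + t) (+-comm k D))))

norm-ascend : ∀ b e r → Norm b (e + 2 * r) e → Norm (not b) (3 * e + r) (e + r)
norm-ascend false e r = transfer⁺ 4 (flip-identity e r)
norm-ascend true  e r = transfer⁻ 4 (flip-identity e r)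

norm-descend : ∀ b e r → Norm b (3 * e + r) (e + r) → Norm (not b) (e + 2 * r) e
norm-descend false e r = transfer⁺ 4 (flip-identity′ e r)
norm-descend true  e r = transfer⁻ 4 (flip-identity′ e r)

lucas-step : ∀ j {e r} → e + 2 * r ≡ L j → e ≡ F j → 3 * e + r ≡ L (suc j) × e + r ≡ F (suc j)
lucas-step j {e} {r} hL hF = cancel-2 (begin
    2 * (3 * e + r)         ≡⟨ expand e r ⟩
    (e + 2 * r) + 5 * e     ≡⟨ cong₂ (λ a b → a + 5 * b) hL hF ⟩
    L j + 5 * F j           ≡⟨ double-L-suc j ⟨
    2 * L (suc j)           ∎)
  , cancel-2 (begin
    2 * (e + r)             ≡⟨ expand′ e r ⟩
    (e + 2 * r) + e         ≡⟨ cong₂ _+_ hL hF ⟩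
    L j + F j               ≡⟨ double-F-suc j ⟨
    2 * F (suc j)           ∎)
  where
  open ≡-Reasoning
  expand : ∀ e r → 2 * (3 * e + r) ≡ (e + 2 * r) + 5 * e
  expand = solve-∀
  expand′ : ∀ e r → 2 * (e + r) ≡ (e + 2 * r) + e
  expand′ = solve-∀

-- The Cassini-type step: (L (j+1), F (j+1)) = (e + 2r, e) with e = F(j+1), r = F j,
-- so the norm of (L (j+2), F (j+2)) = (3e + r, e + r) has the opposite sign.
lucas-norm-suc : ∀ j → Norm (odd (suc j)) (L (suc j)) (F (suc j)) →
                 Norm (odd (suc (suc j))) (L (suc (suc j))) (F (suc (suc j)))
lucas-norm-suc j h = subst₂ (Norm (odd (suc (suc j)))) (proj₁ next) (proj₂ next)
  (norm-ascend (odd (suc j)) (F (suc j)) (F j) (subst (λ z → Norm (odd (suc j)) z (F (suc j))) (L-suc j) h))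
  where
  next : 3 * F (suc j) + F j ≡ L (suc (suc j)) × F (suc j) + F j ≡ F (suc (suc j))
  next = lucas-step (suc j) (sym (L-suc j)) refl

lucas-norm : ∀ j → Norm (odd j) (L j) (F j)
lucas-norm zero = refl
lucas-norm (suc zero) = refl
lucas-norm (suc (suc j)) = lucas-norm-suc j (lucas-norm (suc j))

lucas-norm-even : ∀ m → L (2 * m) * L (2 * m) ≡ 5 * (F (2 * m) * F (2 * m)) + 4
lucas-norm-even m = subst (λ b → Norm b (L (2 * m)) (F (2 * m))) (odd-double m) (lucas-norm (2 * m))

square-reflects-≤ : ∀ {a b} → a * a ≤ b * b → a ≤ b
square-reflects-≤ aa≤bb = ≮⇒≥ (λ b<a → <⇒≱ (*-mono-< b<a b<a) aa≤bb)

square-injective : ∀ {a b} → a * a ≡ b * b → a ≡ b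
square-injective eq = ≤-antisym (square-reflects-≤ (≤-reflexive eq)) (square-reflects-≤ (≤-reflexive (sym eq)))

norm-lower : ∀ b {z x} → Norm b z x → 1 ≤ x → x ≤ z
norm-lower false {z} {x} h _ = square-reflects-≤ (begin
  x * x                          ≤⟨ m≤m+n (x * x) (4 * (x * x) + 4) ⟩
  x * x + (4 * (x * x) + 4)      ≡⟨ +-assoc (x * x) (4 * (x * x)) 4 ⟨
  5 * (x * x) + 4                ≡⟨ h ⟨
  z * z                          ∎)
  where open ≤-Reasoning
norm-lower true {z} {x} h 1≤x = square-reflects-≤ (+-cancelʳ-≤ 4 (x * x) (z * z) (begin
  x * x + 4                      ≤⟨ +-monoʳ-≤ (x * x) (*-monoʳ-≤ 4 (*-mono-≤ 1≤x 1≤x)) ⟩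
  x * x + 4 * (x * x)            ≡⟨ h ⟨
  z * z + 4                      ∎))
  where open ≤-Reasoning

norm-upper : ∀ b {z x} → Norm b z x → 1 ≤ x → z ≤ 3 * x
norm-upper b {z} {x} h 1≤x = square-reflects-≤ (begin
  z * z                          ≤⟨ bound b h ⟩
  5 * (x * x) + 4 * (x * x)      ≡⟨ nine (x * x) ⟩
  9 * (x * x)                    ≡⟨ square-triple x ⟩
  3 * x * (3 * x)                ∎)
  where
  open ≤-Reasoning
  nine : ∀ y → 5 * y + 4 * y ≡ 9 * y
  nine = solve-∀
  square-triple : ∀ x → 9 * (x * x) ≡ 3 * x * (3 * x)
  square-triple = solve-∀
  bound : ∀ b → Norm b z x → z * z ≤ 5 * (x * x) + 4 * (x * x)
  bound false h = subst (_≤ 5 * (x * x) + 4 * (x * x)) (sym h) (+-monoʳ-≤ (5 * (x * x)) (*-monoʳ-≤ 4 (*-mono-≤ 1≤x 1≤x)))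
  bound true h = ≤-trans (m≤m+n (z * z) 4) (subst (_≤ 5 * (x * x) + 4 * (x * x)) (sym h) (m≤m+n _ _))

-- z² + x² + 4 is even for every solution, so z and x have the same parity.
norm-even : ∀ b {z x} → Norm b z x → ∃ λ t → z * z + x * x + 4 ≡ 2 * t
norm-even false {z} {x} h = 3 * (x * x) + 4 , trans (cong (λ w → w + x * x + 4) h) (regroup (x * x))
  where regroup : ∀ y → 5 * y + 4 + y + 4 ≡ 2 * (3 * y + 4)
        regroup = solve-∀
norm-even true {z} {x} h = 3 * (x * x) , trans (regroup (z * z) (x * x)) (trans (cong (_+ x * x) h) (six (x * x)))
  where regroup : ∀ a y → a + y + 4 ≡ (a + 4) + y
        regroup = solve-∀
        six : ∀ y → 5 * y + y ≡ 2 * (3 * y)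
        six = solve-∀

odd-square-sum : ∀ x e t → (x + (1 + 2 * e)) * (x + (1 + 2 * e)) + x * x + 4 ≢ 2 * t
odd-square-sum x e t eq = even≢odd t (x * x + x + 2 * x * e + 2 * e + 2 * e * e + 2) (trans (sym eq) (expand x e))
  where expand : ∀ x e → (x + (1 + 2 * e)) * (x + (1 + 2 * e)) + x * x + 4
                         ≡ 1 + 2 * (x * x + x + 2 * x * e + 2 * e + 2 * e * e + 2)
        expand = solve-∀

halve : ∀ d → ∃ λ e → d ≡ 2 * e ⊎ d ≡ 1 + 2 * e
halve zero = 0 , inj₁ refl
halve (suc d) with halve d
... | e , inj₁ refl = e , inj₂ refl
... | e , inj₂ refl = suc e , inj₁ (sym (*-suc 2 e))

norm-gap-even : ∀ b {z x} → Norm b z x → x ≤ z → ∃ λ e → z ≡ x + 2 * e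
norm-gap-even b {z} {x} h x≤z with halve (z ∸ x)
... | e , inj₁ gap≡2e = e , trans (sym (m+[n∸m]≡n x≤z)) (cong (λ t → x + t) gap≡2e)
... | e , inj₂ gap≡1+2e = ⊥-elim (odd-square-sum x e t (subst (λ w → w * w + x * x + 4 ≡ 2 * t) z≡ even))
  where
  t = proj₁ (norm-even b h)
  even = proj₂ (norm-even b h)
  z≡ : z ≡ x + (1 + 2 * e)
  z≡ = trans (sym (m+[n∸m]≡n x≤z)) (cong (λ t → x + t) gap≡1+2e)

-- For x ≥ 1 every solution is (3e + r, e + r), i.e. e = (z − x)/2 and r = (3x − z)/2
-- are natural numbers.
norm-shape : ∀ b {z x} → Norm b z x → 1 ≤ x → ∃₂ λ e r → z ≡ 3 * e + r × x ≡ e + r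
norm-shape b {z} {x} h 1≤x = e , x ∸ e , trans z≡x+2e (regroup x e (x ∸ e) x≡e+r) , x≡e+r
  where
  gap = norm-gap-even b h (norm-lower b h 1≤x)
  e = proj₁ gap
  z≡x+2e = proj₂ gap
  e≤x : e ≤ x
  e≤x = *-cancelˡ-≤ 2 (+-cancelˡ-≤ x (2 * e) (2 * x) (subst (_≤ 3 * x) z≡x+2e (norm-upper b h 1≤x)))
  x≡e+r : x ≡ e + (x ∸ e)
  x≡e+r = sym (m+[n∸m]≡n e≤x)
  regroup : ∀ x e r → x ≡ e + r → x + 2 * e ≡ 3 * e + r
  regroup x e r refl = rearrange e r
    where rearrange : ∀ e r → e + r + 2 * e ≡ 3 * e + r
          rearrange = solve-∀

norm-diagonal : ∀ b e → Norm b e e → b ≡ true × e ≡ 1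
norm-diagonal false e h = ⊥-elim (m≢1+m+n (e * e) (trans h (regroup (e * e))))
  where regroup : ∀ y → 5 * y + 4 ≡ suc (y + (3 + 4 * y))
        regroup = solve-∀
norm-diagonal true e h = refl , m*n≡1⇒m≡1 e e (*-cancelˡ-≡ (e * e) 1 4 (sym (+-cancelˡ-≡ (e * e) 4 (4 * (e * e)) h)))

LucasPair : Bool → ℕ → ℕ → Set
LucasPair b z x = ∃ λ j → odd j ≡ b × z ≡ L j × x ≡ F j

lucas-pair-ascend : ∀ b e r → LucasPair (not b) (e + 2 * r) e → LucasPair b (3 * e + r) (e + r)
lucas-pair-ascend b e r (j , odd-j , hL , hF) =
  suc j , trans (cong not odd-j) (not-involutive b) , lucas-step j hL hF

diagonal-pair : ∀ b e → Norm b (e + 2 * 0) e → LucasPair b (e + 2 * 0) e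
diagonal-pair b e h with norm-diagonal b e (subst (λ w → Norm b w e) (+-identityʳ e) h)
... | refl , refl = 1 , refl , refl , refl

-- The descended solution (e + 2r, e) is a Lucas–Fibonacci pair, given that all
-- solutions with smaller x < e + r are: either it is diagonal (r = 0) or e < e + r.
previous-pair : ∀ b e r → (∀ {y} → y < e + r → ∀ b z → Norm b z y → LucasPair b z y) →
                Norm b (e + 2 * r) e → LucasPair b (e + 2 * r) e
previous-pair b e zero    _   h = diagonal-pair b e h
previous-pair b e (suc r) rec h = rec (m<m+n e z<s) b (e + 2 * suc r) h

-- One descent step: a solution with x ≥ 1 is the ascent of the solution (e + 2r, e)
-- of the other equation, which is a Lucas–Fibonacci pair by induction.
descent-step : ∀ b {z x} → Norm b z x → 1 ≤ x →
               (∀ {y} → y < x → ∀ b z → Norm b z y → LucasPair b z y) → LucasPair b z x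
descent-step b {z} {x} h 1≤x rec = subst₂ (LucasPair b) (sym z≡) (sym x≡)
  (lucas-pair-ascend b e r (previous-pair (not b) e r rec′ (norm-descend b e r h′)))
  where
  shape = norm-shape b h 1≤x
  e = proj₁ shape
  r = proj₁ (proj₂ shape)
  z≡ : z ≡ 3 * e + r
  z≡ = proj₁ (proj₂ (proj₂ shape))
  x≡ : x ≡ e + r
  x≡ = proj₂ (proj₂ (proj₂ shape))
  h′ : Norm b (3 * e + r) (e + r)
  h′ = subst₂ (Norm b) z≡ x≡ h
  rec′ : ∀ {y} → y < e + r → ∀ b z → Norm b z y → LucasPair b z y
  rec′ y<e+r = rec (subst (_ <_) (sym x≡) y<e+r)

norm-solutions : ∀ x b z → Norm b z x → LucasPair b z x
norm-solutions = <-rec (λ x → ∀ b z → Norm b z x → LucasPair b z x) descent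
  where
  descent : ∀ x → (∀ {y} → y < x → ∀ b z → Norm b z y → LucasPair b z y) →
            ∀ b z → Norm b z x → LucasPair b z x
  descent zero    _   false z h = 0 , refl , square-injective h , refl
  descent zero    _   true  z h = ⊥-elim (m+1+n≢0 (z * z) {3} h)
  descent (suc x) rec b     z h = descent-step b h z<s rec

sum-mono-⊆ : ∀ (f : ℕ → ℕ) {xs ys} → Unique xs → xs ⊆ ys → sum (map f xs) ≤ sum (map f ys)
sum-mono-⊆ f [] _ = z≤n
sum-mono-⊆ f {x ∷ xs} (x∉xs ∷ unique) xs⊆ys with ∈-∃++ (xs⊆ys (here refl))
... | as , bs , refl = begin
  f x + sum (map f xs)            ≤⟨ +-monoʳ-≤ (f x) (sum-mono-⊆ f unique xs⊆as++bs) ⟩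
  sum (map f (x ∷ as ++ bs))      ≡⟨ sum-↭ (Perm.map⁺ f (shift x as bs)) ⟨
  sum (map f (as ++ x ∷ bs))      ∎
  where
  open ≤-Reasoning
  xs⊆as++bs : xs ⊆ as ++ bs
  xs⊆as++bs {y} y∈xs with ∈-++⁻ as (xs⊆ys (there y∈xs))
  ... | inj₁ y∈as = ∈-++⁺ˡ y∈as
  ... | inj₂ (here refl) = ⊥-elim (All.lookup x∉xs y∈xs refl)
  ... | inj₂ (there y∈bs) = ∈-++⁺ʳ as y∈bs

divisors-unique : ∀ n → Unique (divisors n)
divisors-unique n = Unique.filter⁺ (_∣? n) (Unique.map⁺ suc-injective (Unique.upTo⁺ n))

∈-divisors⁺ : ∀ {n d} → 0 < n → d ∣ n → d ∈ divisors n
∈-divisors⁺ {n} {zero} 0<n 0∣n = ⊥-elim (<⇒≢ 0<n (sym (0∣⇒≡0 0∣n)))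
∈-divisors⁺ {n} {suc d} 0<n d∣n =
  ∈-filter⁺ (_∣? n) (∈-map⁺ suc (∈-upTo⁺ (∣⇒≤ ⦃ >-nonZero 0<n ⦄ d∣n))) d∣n

∈-divisors⁻ : ∀ {n d} → d ∈ divisors n → d ∣ n
∈-divisors⁻ {n} d∈ = proj₂ (∈-filter⁻ (_∣? n) {xs = map suc (upTo n)} d∈)

squareSum : List ℕ → ℕ
squareSum ds = sum (map (λ d → d * d) ds)

σ₂≡squareSum : ∀ n → σ₂ n ≡ squareSum (divisors n)
σ₂≡squareSum n = cong sum (map-cong (λ d → cong (d *_) (*-identityʳ d)) (divisors n))

σ₂-upper : ∀ {n} ds → (∀ {d} → d ∣ n → d ∈ ds) → σ₂ n ≤ squareSum ds
σ₂-upper {n} ds covers = subst (_≤ squareSum ds) (sym (σ₂≡squareSum n))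
  (sum-mono-⊆ (λ d → d * d) (divisors-unique n) (λ d∈ → covers (∈-divisors⁻ d∈)))

σ₂-lower : ∀ {n} ds → 0 < n → Unique ds → All (_∣ n) ds → squareSum ds ≤ σ₂ n
σ₂-lower {n} ds 0<n unique ds∣n = subst (squareSum ds ≤_) (sym (σ₂≡squareSum n))
  (sum-mono-⊆ (λ d → d * d) unique (λ d∈ → ∈-divisors⁺ 0<n (All.lookup ds∣n d∈)))

prime-divisors : ∀ {p d} → Prime p → d ∣ p → d ∈ 1 ∷ p ∷ []
prime-divisors pp d∣p with prime⇒irreducible pp d∣p
... | inj₁ refl = here refl
... | inj₂ refl = there (here refl)

coprime-to-prime : ∀ {p d} → Prime p → ¬ p ∣ d → Coprime d p
coprime-to-prime pp p∤d (i∣d , i∣p) with prime⇒irreducible pp i∣p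
... | inj₁ i≡1 = i≡1
... | inj₂ refl = ⊥-elim (p∤d i∣d)

semiprime-divisors : ∀ {p q d} → Prime p → Prime q → d ∣ p * q → d ∈ 1 ∷ p ∷ q ∷ p * q ∷ []
semiprime-divisors {p} {q} {d} pp pq d∣pq with p ∣? d
... | yes (divides e refl) with prime⇒irreducible pq (*-cancelˡ-∣ p ⦃ prime⇒nonZero pp ⦄ (subst (_∣ p * q) (*-comm e p) d∣pq))
...   | inj₁ refl = there (here (+-identityʳ p))
...   | inj₂ refl = there (there (there (here (*-comm q p))))
semiprime-divisors {p} {q} {d} pp pq d∣pq | no p∤d
  with prime⇒irreducible pq (coprime-divisor (coprime-to-prime pp p∤d) d∣pq)
... | inj₁ refl = here refl
... | inj₂ refl = there (there (here refl))

composite-split : ∀ {n} → 1 < n → ¬ Prime n → ∃₂ λ a b → 1 < a × 1 < b × n ≡ a * b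
composite-split {n} 1<n ¬prime with ¬prime⇒composite ⦃ n>1⇒nonTrivial 1<n ⦄ ¬prime
... | hasNonTrivialDivisor {b} d<n (divides a n≡ab) = a , b , 1<a a n≡ab , nonTrivial⇒n>1 b , n≡ab
  where
  1<a : ∀ a → n ≡ a * b → 1 < a
  1<a zero refl = ⊥-elim (<-asym z<s 1<n)
  1<a (suc zero) n≡b = ⊥-elim (<-irrefl (sym (trans n≡b (+-identityʳ b))) d<n)
  1<a (suc (suc a)) _ = s≤s (s≤s z≤n)

data Shape (n : ℕ) : Set where
  prime     : Prime n → Shape n
  semiprime : ∀ {p q} → Prime p → Prime q → n ≡ p * q → Shape n
  triple    : ∀ {x y z} → 1 < x → 1 < y → 1 < z → n ≡ x * y * z → Shape n

shape : ∀ n → 1 < n → Shape n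
shape n 1<n with prime? n
... | yes n-prime = prime n-prime
... | no ¬prime with composite-split 1<n ¬prime
... | a , b , 1<a , 1<b , refl with prime? a | prime? b
... | yes a-prime | yes b-prime = semiprime a-prime b-prime refl
... | no ¬a-prime | _ with composite-split 1<a ¬a-prime
...   | a₁ , a₂ , 1<a₁ , 1<a₂ , refl = triple 1<a₁ 1<a₂ 1<b refl
shape n 1<n | no _ | a , b , 1<a , 1<b , refl | yes _ | no ¬b-prime with composite-split 1<b ¬b-prime
...   | b₁ , b₂ , 1<b₁ , 1<b₂ , refl = triple 1<a 1<b₁ 1<b₂ (sym (*-assoc a b₁ b₂))

Solves : ℕ → ℕ → ℕ → Set
Solves l f n = σ₂ n + f * f ≡ l * n + n * n + 1

-- For a prime solution the square sum of its divisors is 1 + n², so l n = f².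
prime-solution : ∀ {l f n} → Prime n → Solves l f n → l * n ≤ f * f
prime-solution {l} {f} {n} n-prime eqn = +-cancelˡ-≤ (n * n + 1) (l * n) (f * f) (begin
  n * n + 1 + l * n                 ≡⟨ +-comm (n * n + 1) (l * n) ⟩
  l * n + (n * n + 1)               ≡⟨ +-assoc (l * n) (n * n) 1 ⟨
  l * n + n * n + 1                 ≡⟨ eqn ⟨
  σ₂ n + f * f                      ≤⟨ +-monoˡ-≤ (f * f) (σ₂-upper (1 ∷ n ∷ []) (prime-divisors n-prime)) ⟩
  squareSum (1 ∷ n ∷ []) + f * f    ≡⟨ cong (_+ f * f) (square-sum n) ⟩
  n * n + 1 + f * f                 ∎)
  where
  open ≤-Reasoning
  square-sum : ∀ n → 1 + (n * n + 0) ≡ n * n + 1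
  square-sum = solve-∀

-- For n = p² the divisors are 1, p, p²; since l ≥ 3 this forces p² ≤ f².
square-solution : ∀ {l f p} → 3 ≤ l → Prime p → Solves l f (p * p) → p * p ≤ f * f
square-solution {l} {f} {p} 3≤l p-prime eqn = +-cancelˡ-≤ (2 * P + P * P + 1) P (f * f) (begin
  2 * P + P * P + 1 + P                   ≡⟨ regroup P ⟩
  3 * P + P * P + 1                       ≤⟨ +-monoˡ-≤ 1 (+-monoˡ-≤ (P * P) (*-monoˡ-≤ P 3≤l)) ⟩
  l * P + P * P + 1                       ≡⟨ eqn ⟨
  σ₂ P + f * f                            ≤⟨ +-monoˡ-≤ (f * f) (σ₂-upper (1 ∷ p ∷ p ∷ P ∷ []) (semiprime-divisors p-prime p-prime)) ⟩
  squareSum (1 ∷ p ∷ p ∷ P ∷ []) + f * f  ≡⟨ cong (_+ f * f) (square-sum p) ⟩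
  2 * P + P * P + 1 + f * f               ∎)
  where
  open ≤-Reasoning
  P = p * p
  regroup : ∀ P → 2 * P + P * P + 1 + P ≡ 3 * P + P * P + 1
  regroup = solve-∀
  square-sum : ∀ p → 1 + (p * p + (p * p + (p * p * (p * p) + 0))) ≡ 2 * (p * p) + p * p * (p * p) + 1
  square-sum = solve-∀

-- A divisor d of a solution n = a d with 1 < a, 1 < d satisfies d ≤ l a: the distinct
-- divisors 1, d, n give σ₂ n ≥ 1 + d² + n², hence d² ≤ l n.
cofactor-bound : ∀ {l f a d} → 1 < a → 1 < d → Solves l f (a * d) → d ≤ l * a
cofactor-bound {l} {f} {a} {d} 1<a 1<d eqn = *-cancelʳ-≤ d (l * a) d ⦃ d≢0 ⦄ (+-cancelˡ-≤ (n * n + 1) (d * d) (l * a * d) (begin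
  n * n + 1 + d * d                 ≡⟨ regroup (n * n) (d * d) ⟩
  squareSum (1 ∷ d ∷ n ∷ [])        ≤⟨ σ₂-lower (1 ∷ d ∷ n ∷ []) (<-trans z<s 1<n) distinct all-divide ⟩
  σ₂ n                              ≤⟨ m≤m+n (σ₂ n) (f * f) ⟩
  σ₂ n + f * f                      ≡⟨ eqn ⟩
  l * n + n * n + 1                 ≡⟨ regroup′ (l * n) (n * n) ⟩
  n * n + 1 + l * n                 ≡⟨ cong (λ t → n * n + 1 + t) (*-assoc l a d) ⟨
  n * n + 1 + l * a * d             ∎))
  where
  open ≤-Reasoning
  n = a * d
  d≢0 = >-nonZero (<-trans z<s 1<d)
  d<n : d < n
  d<n = subst (d <_) (*-comm d a) (m<m*n d a ⦃ d≢0 ⦄ 1<a)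
  1<n : 1 < n
  1<n = <-trans 1<d d<n
  distinct : Unique (1 ∷ d ∷ n ∷ [])
  distinct = (<⇒≢ 1<d ∷ <⇒≢ 1<n ∷ []) ∷ (<⇒≢ d<n ∷ []) ∷ [] ∷ []
  all-divide : All (_∣ n) (1 ∷ d ∷ n ∷ [])
  all-divide = 1∣ n ∷ n∣m*n a ∷ ∣-refl ∷ []
  regroup : ∀ N D → N + 1 + D ≡ 1 + (D + (N + 0))
  regroup = solve-∀
  regroup′ : ∀ A N → A + N + 1 ≡ N + 1 + A
  regroup′ = solve-∀

-- A solution with three factors x, y, z > 1 is at most l³: the cofactor bounds
-- yz ≤ lx, xz ≤ ly, xy ≤ lz multiply to n² ≤ l³ n.
three-factor-bound : ∀ {l f x y z} → 1 < x → 1 < y → 1 < z → Solves l f (x * y * z) → x * y * z ≤ l * (l * l)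
three-factor-bound {l} {f} {x} {y} {z} 1<x 1<y 1<z eqn = *-cancelʳ-≤ n (l * (l * l)) n ⦃ n≢0 ⦄ (begin
  n * n                             ≡⟨ cofactor-product x y z ⟩
  y * z * (x * z * (x * y))         ≤⟨ *-mono-≤ yz≤lx (*-mono-≤ xz≤ly xy≤lz) ⟩
  l * x * (l * y * (l * z))         ≡⟨ bound-product l x y z ⟩
  l * (l * l) * n                   ∎)
  where
  open ≤-Reasoning
  n = x * y * z
  n≢0 = >-nonZero (<-trans z<s (*-mono-< (*-mono-< 1<x 1<y) 1<z))
  solves : ∀ {m} → n ≡ m → Solves l f m
  solves n≡m = subst (Solves l f) n≡m eqn
  yz≤lx : y * z ≤ l * x
  yz≤lx = cofactor-bound {l} {f} 1<x (*-mono-< 1<y 1<z) (solves (*-assoc x y z))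
  xz≤ly : x * z ≤ l * y
  xz≤ly = cofactor-bound {l} {f} 1<y (*-mono-< 1<x 1<z) (solves (rotate x y z))
    where rotate : ∀ x y z → x * y * z ≡ y * (x * z)
          rotate = solve-∀
  xy≤lz : x * y ≤ l * z
  xy≤lz = cofactor-bound {l} {f} 1<z (*-mono-< 1<x 1<y) (solves (*-comm (x * y) z))
  cofactor-product : ∀ x y z → x * y * z * (x * y * z) ≡ y * z * (x * z * (x * y))
  cofactor-product = solve-∀
  bound-product : ∀ l x y z → l * x * (l * y * (l * z)) ≡ l * (l * l) * (x * y * z)
  bound-product = solve-∀

-- For distinct primes p, q the divisors of p q are 1, p, q, p q, and the equation
-- becomes p² + q² + f² = l p q.
semiprime-equation : ∀ {l f p q} → Prime p → Prime q → p < q → Solves l f (p * q) →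
                     p * p + q * q + f * f ≡ l * p * q
semiprime-equation {l} {f} {p} {q} p-prime q-prime p<q eqn =
  +-cancelʳ-≡ (n * n + 1) _ _ (begin
    p * p + q * q + f * f + (n * n + 1)   ≡⟨ regroup p q (f * f) ⟩
    squareSum divisor-list + f * f        ≡⟨ cong (_+ f * f) σ₂-exact ⟨
    σ₂ n + f * f                          ≡⟨ eqn ⟩
    l * n + n * n + 1                     ≡⟨ regroup′ l p q ⟩
    l * p * q + (n * n + 1)               ∎)
  where
  open ≡-Reasoning
  n = p * q
  divisor-list = 1 ∷ p ∷ q ∷ n ∷ []
  1<p = nonTrivial⇒n>1 p ⦃ prime⇒nonTrivial p-prime ⦄
  1<q = nonTrivial⇒n>1 q ⦃ prime⇒nonTrivial q-prime ⦄
  q<n : q < n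
  q<n = subst (q <_) (*-comm q p) (m<m*n q p ⦃ prime⇒nonZero q-prime ⦄ 1<p)
  distinct : Unique divisor-list
  distinct = (<⇒≢ 1<p ∷ <⇒≢ 1<q ∷ <⇒≢ (<-trans 1<q q<n) ∷ [])
           ∷ (<⇒≢ p<q ∷ <⇒≢ (<-trans p<q q<n) ∷ []) ∷ (<⇒≢ q<n ∷ []) ∷ [] ∷ []
  σ₂-exact : σ₂ n ≡ squareSum divisor-list
  σ₂-exact = ≤-antisym (σ₂-upper divisor-list (semiprime-divisors p-prime q-prime))
                       (σ₂-lower divisor-list (<-trans z<s (<-trans 1<q q<n)) distinct (1∣ n ∷ m∣m*n q ∷ n∣m*n p ∷ ∣-refl ∷ []))
  regroup : ∀ p q F → p * p + q * q + F + (p * q * (p * q) + 1) ≡ 1 + (p * p + (q * q + (p * q * (p * q) + 0))) + F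
  regroup = solve-∀
  regroup′ : ∀ l p q → l * (p * q) + p * q * (p * q) + 1 ≡ l * p * q + (p * q * (p * q) + 1)
  regroup′ = solve-∀

-- For p ≤ q with p² + q² + f² = l p q: either q ≤ f², or q is at least the
-- smaller root l p / 2 of the quadratic in q, i.e. 2q = l p + w.
markov-dichotomy : ∀ {l f p q} → p ≤ q → p * p + q * q + f * f ≡ l * p * q →
                   q ≤ f * f ⊎ ∃ λ w → 2 * q ≡ l * p + w
markov-dichotomy {l} {f} {p} {q} p≤q markov with l * p ≤? 2 * q
... | yes lp≤2q = inj₂ (2 * q ∸ l * p , sym (m+[n∸m]≡n lp≤2q))
... | no lp≰2q = inj₁ (+-cancelˡ-≤ (p * p + q * q) q (f * f) (begin
  p * p + q * q + q            ≤⟨ +-monoˡ-≤ q (+-monoˡ-≤ (q * q) (*-mono-≤ p≤q p≤q)) ⟩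
  q * q + q * q + q            ≡⟨ regroup q ⟩
  (1 + 2 * q) * q              ≤⟨ *-monoˡ-≤ q (≰⇒> lp≰2q) ⟩
  l * p * q                    ≡⟨ markov ⟨
  p * p + q * q + f * f        ∎))
  where
  open ≤-Reasoning
  regroup : ∀ q → q * q + q * q + q ≡ (1 + 2 * q) * q
  regroup = solve-∀

-- When l² = 5f² + 4, the relation 2q = l p + w turns p² + q² + f² = l p q into
-- w² + 4f² = 5 f² p² (the discriminant of the quadratic in q).
discriminant : ∀ {l f p q w} → l * l ≡ 5 * (f * f) + 4 → p * p + q * q + f * f ≡ l * p * q →
               2 * q ≡ l * p + w → w * w + 4 * (f * f) ≡ f * f * (5 * (p * p))
discriminant {l} {f} {p} {q} {w} norm markov 2q≡lp+w =
  +-cancelˡ-≡ (4 * (p * p)) _ _ (+-cancelʳ-≡ (2 * l * p * (l * p + w)) _ _ (begin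
    4 * (p * p) + (w * w + 4 * (f * f)) + 2 * l * p * (l * p + w)
      ≡⟨ expand l p w (f * f) ⟩
    l * l * (p * p) + (4 * (p * p) + (l * p + w) * (l * p + w) + 4 * (f * f))
      ≡⟨ cong (λ t → l * l * (p * p) + (4 * (p * p) + t * t + 4 * (f * f))) 2q≡lp+w ⟨
    l * l * (p * p) + (4 * (p * p) + 2 * q * (2 * q) + 4 * (f * f))
      ≡⟨ cong₂ _+_ (cong (_* (p * p)) norm) times-four ⟩
    (5 * (f * f) + 4) * (p * p) + 2 * l * p * (2 * q)
      ≡⟨ cong₂ _+_ (regroup (f * f) (p * p)) (cong (2 * l * p *_) 2q≡lp+w) ⟩
    4 * (p * p) + f * f * (5 * (p * p)) + 2 * l * p * (l * p + w)  ∎))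
  where
  open ≡-Reasoning
  times-four : 4 * (p * p) + 2 * q * (2 * q) + 4 * (f * f) ≡ 2 * l * p * (2 * q)
  times-four = begin
    4 * (p * p) + 2 * q * (2 * q) + 4 * (f * f)   ≡⟨ scale (p * p) q (f * f) ⟩
    4 * (p * p + q * q + f * f)                   ≡⟨ cong (4 *_) markov ⟩
    4 * (l * p * q)                               ≡⟨ scale′ l p q ⟩
    2 * l * p * (2 * q)                           ∎
    where
    scale : ∀ P q F → 4 * P + 2 * q * (2 * q) + 4 * F ≡ 4 * (P + q * q + F)
    scale = solve-∀
    scale′ : ∀ l p q → 4 * (l * p * q) ≡ 2 * l * p * (2 * q)
    scale′ = solve-∀
  expand : ∀ l p w F → 4 * (p * p) + (w * w + 4 * F) + 2 * l * p * (l * p + w)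
                     ≡ l * l * (p * p) + (4 * (p * p) + (l * p + w) * (l * p + w) + 4 * F)
  expand = solve-∀
  regroup : ∀ F P → (5 * F + 4) * P ≡ 4 * P + F * (5 * P)
  regroup = solve-∀

-- If a² divides b² then a divides b: writing a = a′g, b = b′g with g = gcd a b and
-- a′, b′ coprime, a′² ∣ b′² forces a′ = 1.
square-divides : ∀ a b .⦃ _ : NonZero a ⦄ → a * a ∣ b * b → a ∣ b
square-divides a b aa∣bb = subst (_∣ b) g≡a (gcd[m,n]∣n a b)
  where
  g = gcd a b
  instance
    g≢0 : NonZero g
    g≢0 = ≢-nonZero (gcd[m,n]≢0 a b (inj₁ (≢-nonZero⁻¹ a)))
    gg≢0 : NonZero (g * g)
    gg≢0 = m*n≢0 g g
  a′ = a / g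
  b′ = b / g
  squares : ∀ x g → x * g * (x * g) ≡ x * x * (g * g)
  squares = solve-∀
  a′a′∣b′b′ : a′ * a′ ∣ b′ * b′
  a′a′∣b′b′ = *-cancelʳ-∣ (g * g) (subst₂ _∣_
    (trans (cong (λ t → t * t) (sym (m/n*n≡m (gcd[m,n]∣m a b)))) (squares a′ g))
    (trans (cong (λ t → t * t) (sym (m/n*n≡m (gcd[m,n]∣n a b)))) (squares b′ g)) aa∣bb)
  a′∣b′ : a′ ∣ b′
  a′∣b′ = coprime-divisor (coprime-/gcd a b) (∣-trans (m∣m*n a′) a′a′∣b′b′)
  g≡a : g ≡ a
  g≡a = begin
    g           ≡⟨ *-identityˡ g ⟨
    1 * g       ≡⟨ cong (_* g) (coprime-/gcd a b (∣-refl , a′∣b′)) ⟨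
    a′ * g      ≡⟨ m/n*n≡m (gcd[m,n]∣m a b) ⟩
    a           ∎
    where open ≡-Reasoning

-- Large solutions come from odd Lucas–Fibonacci pairs: if l² = 5f² + 4 with f > 0,
-- p² + q² + f² = l p q and 2q = l p + w, then w = f z with z² + 4 = 5 p², so
-- (z, p) = (L (2k+1), F (2k+1)).
semiprime-lucas : ∀ {l f p q w} → 0 < f → l * l ≡ 5 * (f * f) + 4 →
                  p * p + q * q + f * f ≡ l * p * q → 2 * q ≡ l * p + w →
                  ∃ λ k → p ≡ F (2 * k + 1) × w ≡ f * L (2 * k + 1)
semiprime-lucas {l} {f} {p} {q} {w} 0<f norm markov root = k , trans p≡Fj (cong F j≡) , w≡fLj
  where
  instance
    f≢0 = >-nonZero 0<f
    ff≢0 = m*n≢0 f f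
  disc : w * w + 4 * (f * f) ≡ f * f * (5 * (p * p))
  disc = discriminant {l} {f} {p} {q} {w} norm markov root
  ff∣ww : f * f ∣ w * w
  ff∣ww = ∣m+n∣m⇒∣n (divides (5 * (p * p)) (trans (+-comm (4 * (f * f)) (w * w)) (trans disc (*-comm (f * f) _))))
                    (n∣m*n 4)
  f∣w : f ∣ w
  f∣w = square-divides f w ff∣ww
  z = _∣_.quotient f∣w
  w≡zf : w ≡ z * f
  w≡zf = _∣_.equality f∣w
  scale : ∀ z f → f * f * (z * z + 4) ≡ z * f * (z * f) + 4 * (f * f)
  scale = solve-∀
  z-norm : z * z + 4 ≡ 5 * (p * p)
  z-norm = *-cancelˡ-≡ (z * z + 4) (5 * (p * p)) (f * f)
    (trans (scale z f) (trans (cong (λ t → t * t + 4 * (f * f)) (sym w≡zf)) disc))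
  pair = norm-solutions p true z z-norm
  j = proj₁ pair
  p≡Fj : p ≡ F j
  p≡Fj = proj₂ (proj₂ (proj₂ pair))
  k = proj₁ (odd⇒2k+1 j (proj₁ (proj₂ pair)))
  j≡ : j ≡ 2 * k + 1
  j≡ = proj₂ (odd⇒2k+1 j (proj₁ (proj₂ pair)))
  w≡fLj : w ≡ f * L (2 * k + 1)
  w≡fLj = trans w≡zf (trans (*-comm z f) (cong (f *_) (trans (proj₁ (proj₂ (proj₂ pair))) (cong L j≡))))

record LargeSemiprime (l f n : ℕ) : Set where
  constructor large-semiprime
  field
    {p q w}    : ℕ
    p-prime    : Prime p
    q-prime    : Prime q
    n≡pq       : n ≡ p * q
    markov     : p * p + q * q + f * f ≡ l * p * q
    lower-root : 2 * q ≡ l * p + w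

cube-bound : ∀ K {a} → a ≤ K * (K * K) → a ≤ K ^ 3
cube-bound K {a} a≤ = subst (a ≤_) (cong (λ t → K * (K * t)) (sym (*-identityʳ K))) a≤

linear-bound : ∀ {K a} → 1 ≤ K → a ≤ K → a ≤ K ^ 3
linear-bound {K} 1≤K a≤K = cube-bound K (≤-trans a≤K (≤-trans (m≤m*n K K) (m≤n*m (K * K) K)))
  where instance _ = >-nonZero 1≤K

ordered-semiprime : ∀ {l f K p q} → 1 ≤ K → f * f ≤ K → Prime p → Prime q → p < q → Solves l f (p * q) →
                    p * q ≤ K ^ 3 ⊎ LargeSemiprime l f (p * q)
ordered-semiprime {l} {f} {K} {p} {q} 1≤K ff≤K p-prime q-prime p<q eqn with markov-dichotomy {l} {f} (<⇒≤ p<q) markov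
  where markov = semiprime-equation {l} {f} p-prime q-prime p<q eqn
... | inj₁ q≤ff = inj₁ (cube-bound K (begin
  p * q               ≤⟨ *-monoˡ-≤ q (<⇒≤ p<q) ⟩
  q * q               ≤⟨ *-mono-≤ (≤-trans q≤ff ff≤K) (≤-trans q≤ff ff≤K) ⟩
  K * K               ≤⟨ m≤n*m (K * K) K ⦃ >-nonZero 1≤K ⦄ ⟩
  K * (K * K)         ∎))
  where open ≤-Reasoning
... | inj₂ (w , root) = inj₂ (large-semiprime p-prime q-prime refl (semiprime-equation {l} {f} p-prime q-prime p<q eqn) root)

small-or-large : ∀ {l f K n} → 3 ≤ l → l ≤ K → f * f ≤ K → 1 < n → Solves l f n →
                 n ≤ K ^ 3 ⊎ LargeSemiprime l f n
small-or-large {l} {f} {K} {n} 3≤l l≤K ff≤K 1<n eqn = by-shape (shape n 1<n)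
  where
  1≤K : 1 ≤ K
  1≤K = ≤-trans (s≤s z≤n) (≤-trans 3≤l l≤K)
  solves : ∀ {m} → n ≡ m → Solves l f m
  solves n≡m = subst (Solves l f) n≡m eqn
  ordered : ∀ {p q} → Prime p → Prime q → p < q → n ≡ p * q → n ≤ K ^ 3 ⊎ LargeSemiprime l f n
  ordered p-prime q-prime p<q n≡pq = Sum.map (subst (_≤ K ^ 3) (sym n≡pq)) (subst (LargeSemiprime l f) (sym n≡pq))
    (ordered-semiprime 1≤K ff≤K p-prime q-prime p<q (solves n≡pq))
  by-shape : Shape n → n ≤ K ^ 3 ⊎ LargeSemiprime l f n
  by-shape (prime n-prime) = inj₁ (linear-bound 1≤K (begin
    n               ≤⟨ m≤n*m n l ⦃ >-nonZero (≤-trans (s≤s z≤n) 3≤l) ⦄ ⟩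
    l * n           ≤⟨ prime-solution {l} {f} n-prime eqn ⟩
    f * f           ≤⟨ ff≤K ⟩
    K               ∎))
    where open ≤-Reasoning
  by-shape (triple 1<x 1<y 1<z n≡xyz) = inj₁ (subst (_≤ K ^ 3) (sym n≡xyz) (cube-bound K
    (≤-trans (three-factor-bound {l} {f} 1<x 1<y 1<z (solves n≡xyz)) (*-mono-≤ l≤K (*-mono-≤ l≤K l≤K)))))
  by-shape (semiprime {p} {q} p-prime q-prime n≡pq) with <-cmp p q
  ... | tri< p<q _ _ = ordered p-prime q-prime p<q n≡pq
  ... | tri≈ _ refl _ = inj₁ (subst (_≤ K ^ 3) (sym n≡pq)
          (linear-bound 1≤K (≤-trans (square-solution {l} {f} 3≤l p-prime (solves n≡pq)) ff≤K)))
  ... | tri> _ _ q<p = ordered q-prime p-prime q<p (trans n≡pq (*-comm p q))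

solves-from-ℤ : ∀ {l f n} → (+ σ₂ n) -ℤ (+ (n ^ 2)) ≡ (+ l) *ℤ (+ n) -ℤ ((+ (f ^ 2)) -ℤ (+ 1)) → Solves l f n
solves-from-ℤ {l} {f} {n} eq = subst₂ (λ a b → σ₂ n + a ≡ l * n + b + 1) (square f) (square n) (+-injective (begin
  + σ₂ n +ℤ + (f ^ 2)                                     ≡⟨ add-back (+ σ₂ n) (+ (n ^ 2)) (+ (f ^ 2)) ⟨
  (+ σ₂ n -ℤ + (n ^ 2)) +ℤ (+ (n ^ 2) +ℤ + (f ^ 2))       ≡⟨ cong (_+ℤ (+ (n ^ 2) +ℤ + (f ^ 2))) eq ⟩
  (+ l *ℤ + n -ℤ (+ (f ^ 2) -ℤ + 1)) +ℤ (+ (n ^ 2) +ℤ + (f ^ 2))  ≡⟨ rearrange (+ l *ℤ + n) (+ (n ^ 2)) (+ (f ^ 2)) ⟩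
  + l *ℤ + n +ℤ + (n ^ 2) +ℤ + 1                          ≡⟨ cong (λ t → t +ℤ + (n ^ 2) +ℤ + 1) (pos-* l n) ⟨
  + (l * n + n ^ 2 + 1)                                   ∎))
  where
  open ≡-Reasoning
  square : ∀ a → a ^ 2 ≡ a * a
  square a = cong (a *_) (*-identityʳ a)
  add-back : ∀ a b c → (a -ℤ b) +ℤ (b +ℤ c) ≡ a +ℤ c
  add-back = ℤ-Solver.solve-∀
  rearrange : ∀ x b c → (x -ℤ (c -ℤ + 1)) +ℤ (b +ℤ c) ≡ x +ℤ b +ℤ + 1
  rearrange = ℤ-Solver.solve-∀

norm-3≤l : ∀ {l f} → 0 < f → l * l ≡ 5 * (f * f) + 4 → 3 ≤ l
norm-3≤l {l} {f} 0<f norm = square-reflects-≤ (subst (9 ≤_) (sym norm) (+-monoˡ-≤ 4 (*-monoʳ-≤ 5 (*-mono-≤ 0<f 0<f))))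

X-bounds : ∀ {l f} → 1 ≤ l → 1 ≤ f → l ≤ l + f ^ 2 ∸ 1 × f * f ≤ l + f ^ 2 ∸ 1
X-bounds {l} {f} 1≤l 1≤f =
    subst (_≤ l + f ^ 2 ∸ 1) (m+n∸n≡m l 1) (∸-monoˡ-≤ 1 (+-monoʳ-≤ l (subst (1 ≤_) ff≡f² (*-mono-≤ 1≤f 1≤f))))
  , subst (_≤ l + f ^ 2 ∸ 1) (sym ff≡f²) (∸-monoˡ-≤ 1 (+-monoˡ-≤ (f ^ 2) 1≤l))
  where
  ff≡f² : f * f ≡ f ^ 2
  ff≡f² = cong (f *_) (sym (*-identityʳ f))

odd-partner : ∀ m k {q} → 2 * q ≡ L (2 * m) * F (2 * k + 1) + F (2 * m) * L (2 * k + 1) → q ≡ F (2 * k + 2 * m + 1)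
odd-partner m k root = trans (cancel-2 (trans root (F-add (2 * m) (2 * k + 1)))) (cong F (reindex m k))
  where reindex : ∀ m k → 2 * m + (2 * k + 1) ≡ 2 * k + 2 * m + 1
        reindex = solve-∀

fibonacci-semiprime : ∀ m {n} → 0 < m → LargeSemiprime (L (2 * m)) (F (2 * m)) n →
  ∃ λ k → n ≡ F (2 * k + 1) * F (2 * k + 2 * m + 1) × Prime (F (2 * k + 1)) × Prime (F (2 * k + 2 * m + 1))
fibonacci-semiprime m 0<m (large-semiprime {p} {q} {w} p-prime q-prime n≡pq markov root) =
  k , trans n≡pq (cong₂ _*_ p≡ q≡) , subst Prime p≡ p-prime , subst Prime q≡ q-prime
  where
  lucas = semiprime-lucas {L (2 * m)} {F (2 * m)} {p} {q} {w} (F-even-pos m 0<m) (lucas-norm-even m) markov root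
  k = proj₁ lucas
  p≡ : p ≡ F (2 * k + 1)
  p≡ = proj₁ (proj₂ lucas)
  q≡ : q ≡ F (2 * k + 2 * m + 1)
  q≡ = odd-partner m k (trans root (cong₂ (λ a b → L (2 * m) * a + b) p≡ (proj₂ (proj₂ lucas))))

theorem1p3 : (m n : ℕ) → 0 < m → 0 < n →
    (+ σ₂ n) -ℤ (+ (n ^ 2)) ≡ (+ L (2 * m)) *ℤ (+ n) -ℤ ((+ (F (2 * m) ^ 2)) -ℤ (+ 1)) →
    n > (L (2 * m) + F (2 * m) ^ 2 ∸ 1) ^ 3 →
    (∃ λ k → n ≡ F (2 * k + 1) * F (2 * k + 2 * m + 1)
        × Prime (F (2 * k + 1)) × Prime (F (2 * k + 2 * m + 1)))
    ⊎
    (∃ λ k → k < m × 2 * k + 1 ≢ m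
        × n ≡ F (2 * k + 1) * F (2 * m ∸ 2 * k ∸ 1)
        × Prime (F (2 * k + 1)) × Prime (F (2 * m ∸ 2 * k ∸ 1)))
theorem1p3 m n 0<m _ eqn n>X³ =
  [ (λ n≤X³ → ⊥-elim (<⇒≱ n>X³ n≤X³)) , (λ large → inj₁ (fibonacci-semiprime m 0<m large)) ]′
  (small-or-large 3≤l l≤X ff≤X 1<n (solves-from-ℤ {L (2 * m)} {F (2 * m)} {n} eqn))
  where
  X = L (2 * m) + F (2 * m) ^ 2 ∸ 1
  0<f = F-even-pos m 0<m
  3≤l = norm-3≤l 0<f (lucas-norm-even m)
  bounds = X-bounds (≤-trans (s≤s z≤n) 3≤l) 0<f
  l≤X = proj₁ bounds
  ff≤X = proj₂ bounds
  1<n : 1 < n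
  1<n = ≤-<-trans (m^n>0 X ⦃ >-nonZero (≤-trans (≤-trans (s≤s z≤n) 3≤l) l≤X) ⦄ 3) n>X³
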